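{- For $n\ge4$ let $g_n:\{0,1\}^n\to\{0,1\}$ be defined by $g_n(x_1,\dots,x_n)=0$ if $\#\{i:x_i=0\}\in\{1,n\}$ and $g_n(x_1,\dots,x_n)=1$ otherwise. Then $(g_n)_{n\ge4}$ is an infinite antichain with respect to $\preceq_{\bf V}$: for $m\ne n$, $g_m\not\preceq_{\bf V}g_n$.
   Context: For an $m$-ary Boolean function $g$ and an $n$-ary Boolean function $f$, $g\preceq_{\bf V}f$ means $g=f(p_1,\dots,p_n)$ for some $m$-ary projections $p_1,\dots,p_n$, where $f(p_1,\dots,p_n)({\bf a})=f(p_1({\bf a}),\dots,p_n({\bf a}))$. -}

module Defs where

open import Data.Nat using (ℕ; zero; suc; _+_)
open import Data.Bool using (Bool; true; false; if_then_else_)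
open import Data.Fin using (Fin)
open import Data.Product using (Σ)
open import Relation.Binary.PropositionalEquality using (_≡_)
open import Relation.Nullary using (¬_)
open import Data.Nat using (_≟_)
open import Relation.Nullary.Decidable using (⌊_⌋)
open import Data.Bool using (_∨_)

BoolFun : ℕ → Set
BoolFun n = (Fin n → Bool) → Bool

proj : (m : ℕ) → Fin m → BoolFun m
proj m i a = a i

compose : {m n : ℕ} → BoolFun n → (Fin n → BoolFun m) → BoolFun m
compose f p a = f (λ j → p j a)

_⪯V_ : {m n : ℕ} → BoolFun m → BoolFun n → Set
_⪯V_ {m} {n} g f =
  Σ (Fin n → Fin m) λ σ → ∀ (a : Fin m → Bool) → g a ≡ compose f (λ j → proj m (σ j)) a

zeros : (n : ℕ) → (Fin n → Bool) → ℕ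
zeros zero x = 0
zeros (suc n) x = (if x Fin.zero then 0 else 1) + zeros n (λ i → x (Fin.suc i))

g : (n : ℕ) → BoolFun n
g n x = if ⌊ zeros n x ≟ 1 ⌋ ∨ ⌊ zeros n x ≟ n ⌋ then false else true

module Submission where

open import Defs
open import Data.Nat using (ℕ; _≤_)
open import Relation.Binary.PropositionalEquality using (_≡_)
open import Relation.Nullary using (¬_)

open import Data.Nat using (zero; suc; _+_; _<_; z≤n; s≤s; _≟_)
open import Data.Nat.Properties using (≤-refl; ≤-trans; n≤1+n; +-comm; +-suc; +-monoʳ-≤; m+1+n≰m)
open import Data.Bool using (Bool; true; false; _∧_; _∨_)
open import Data.Bool.Properties using (∨-zeroʳ)
open import Data.Fin using (Fin)
open import Data.Product using (Σ-syntax; _×_; _,_)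
open import Data.Sum using (_⊎_; inj₁; inj₂)
open import Data.Empty using (⊥-elim)
open import Function using (_∘_)
open import Relation.Nullary using (yes; no)
open import Relation.Binary.PropositionalEquality
  using (_≢_; refl; sym; trans; cong; cong₂; subst; module ≡-Reasoning)
open ≡-Reasoning

-- If g m = g n ∘ σ for σ : Fin n → Fin m, then feeding g m the input with a single zero at k
-- shows that the fibre of σ over k has size 1 or n.  Size n would leave the fibre over any other
-- point empty, so every fibre is a singleton, and counting the zeros of the constant-false input
-- fibre by fibre gives n = m.

hole : {m : ℕ} → ℕ → Fin m → Bool
hole zero    Fin.zero    = false
hole zero    (Fin.suc _) = true
hole (suc k) Fin.zero    = true
hole (suc k) (Fin.suc x) = hole k x

holesBelow : {m : ℕ} → ℕ → Fin m → Bool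
holesBelow zero    x           = true
holesBelow (suc k) Fin.zero    = false
holesBelow (suc k) (Fin.suc x) = holesBelow k x

holesBelow-suc : ∀ {m} k (x : Fin m) → holesBelow (suc k) x ≡ holesBelow k x ∧ hole k x
holesBelow-suc zero    Fin.zero    = refl
holesBelow-suc zero    (Fin.suc x) = refl
holesBelow-suc (suc k) Fin.zero    = refl
holesBelow-suc (suc k) (Fin.suc x) = holesBelow-suc k x

holesBelow-∨-hole : ∀ {m} k (x : Fin m) → holesBelow k x ∨ hole k x ≡ true
holesBelow-∨-hole zero    x           = refl
holesBelow-∨-hole (suc k) Fin.zero    = refl
holesBelow-∨-hole (suc k) (Fin.suc x) = holesBelow-∨-hole k x

holesBelow-≥ : ∀ {m} k (x : Fin m) → m ≤ k → holesBelow k x ≡ false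
holesBelow-≥ (suc k) Fin.zero    _         = refl
holesBelow-≥ (suc k) (Fin.suc x) (s≤s m≤k) = holesBelow-≥ k x m≤k

hole-∨-hole : ∀ {m} i j (x : Fin m) → i ≢ j → hole i x ∨ hole j x ≡ true
hole-∨-hole zero    zero    x           i≢j = ⊥-elim (i≢j refl)
hole-∨-hole zero    (suc j) Fin.zero    _   = refl
hole-∨-hole zero    (suc j) (Fin.suc x) _   = refl
hole-∨-hole (suc i) zero    Fin.zero    _   = refl
hole-∨-hole (suc i) zero    (Fin.suc x) _   = ∨-zeroʳ (hole i x)
hole-∨-hole (suc i) (suc j) Fin.zero    _   = refl
hole-∨-hole (suc i) (suc j) (Fin.suc x) i≢j = hole-∨-hole i j x (i≢j ∘ cong suc)

zeros-cong : ∀ n {x y : Fin n → Bool} → (∀ j → x j ≡ y j) → zeros n x ≡ zeros n y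
zeros-cong zero    x≗y = refl
zeros-cong (suc n) x≗y rewrite x≗y Fin.zero = cong (_ +_) (zeros-cong n (x≗y ∘ Fin.suc))

zeros-≤ : ∀ n (x : Fin n → Bool) → zeros n x ≤ n
zeros-≤ zero    x = z≤n
zeros-≤ (suc n) x with x Fin.zero
... | true  = ≤-trans (zeros-≤ n (x ∘ Fin.suc)) (n≤1+n n)
... | false = s≤s (zeros-≤ n (x ∘ Fin.suc))

zeros-true : ∀ n → zeros n (λ _ → true) ≡ 0
zeros-true zero    = refl
zeros-true (suc n) = zeros-true n

zeros-false : ∀ n → zeros n (λ _ → false) ≡ n
zeros-false zero    = refl
zeros-false (suc n) = cong suc (zeros-false n)

zeros-hole : ∀ m k → k < m → zeros m (hole k) ≡ 1
zeros-hole (suc m) zero    _         = cong suc (zeros-true m)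
zeros-hole (suc m) (suc k) (s≤s k<m) = zeros-hole m k k<m

zeros-∧ : ∀ n (x y : Fin n → Bool) → (∀ j → x j ∨ y j ≡ true) →
          zeros n (λ j → x j ∧ y j) ≡ zeros n x + zeros n y
zeros-∧ zero x y disjoint = refl
zeros-∧ (suc n) x y disjoint
  with x Fin.zero | y Fin.zero | disjoint Fin.zero
     | zeros-∧ n (x ∘ Fin.suc) (y ∘ Fin.suc) (disjoint ∘ Fin.suc)
... | true  | true  | _ | ih = ih
... | true  | false | _ | ih = trans (cong suc ih) (sym (+-suc _ _))
... | false | true  | _ | ih = cong suc ih

module Fibres {n m : ℕ} (σ : Fin n → Fin m) where

  fibreSize : ℕ → ℕ
  fibreSize k = zeros n (hole k ∘ σ)

  fibreSize-+-≤ : ∀ {i j} → i ≢ j → fibreSize i + fibreSize j ≤ n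
  fibreSize-+-≤ {i} {j} i≢j =
    subst (_≤ n) (zeros-∧ n _ _ (λ x → hole-∨-hole i j (σ x) i≢j)) (zeros-≤ n _)

  zeros-holesBelow : ∀ k → (∀ i → i < k → fibreSize i ≡ 1) → zeros n (holesBelow k ∘ σ) ≡ k
  zeros-holesBelow zero    _         = zeros-true n
  zeros-holesBelow (suc k) singleton = begin
    zeros n (holesBelow (suc k) ∘ σ)                  ≡⟨ zeros-cong n (λ x → holesBelow-suc k (σ x)) ⟩
    zeros n (λ x → holesBelow k (σ x) ∧ hole k (σ x)) ≡⟨ zeros-∧ n _ _ (λ x → holesBelow-∨-hole k (σ x)) ⟩
    zeros n (holesBelow k ∘ σ) + fibreSize k         ≡⟨ cong₂ _+_ (zeros-holesBelow k singleton<k) (singleton k ≤-refl) ⟩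
    k + 1                                             ≡⟨ +-comm k 1 ⟩
    suc k                                             ∎
    where
    singleton<k : ∀ i → i < k → fibreSize i ≡ 1
    singleton<k i i<k = singleton i (≤-trans i<k (n≤1+n k))

  singleton-fibres⇒≡ : (∀ k → k < m → fibreSize k ≡ 1) → n ≡ m
  singleton-fibres⇒≡ singleton = begin
    n                          ≡⟨ sym (zeros-false n) ⟩
    zeros n (λ _ → false)      ≡⟨ zeros-cong n (λ x → sym (holesBelow-≥ m (σ x) ≤-refl)) ⟩
    zeros n (holesBelow m ∘ σ) ≡⟨ zeros-holesBelow m singleton ⟩
    m                          ∎

  another-point : 2 ≤ m → ∀ k → Σ[ j ∈ ℕ ] j < m × j ≢ k
  another-point 2≤m zero    = 1 , 2≤m , λ ()
  another-point 2≤m (suc k) = 0 , ≤-trans (s≤s z≤n) 2≤m , λ ()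

  one-or-all⇒singleton : 2 ≤ m → 1 ≤ n →
                         (∀ k → k < m → fibreSize k ≡ 1 ⊎ fibreSize k ≡ n) →
                         ∀ k → k < m → fibreSize k ≡ 1
  one-or-all⇒singleton 2≤m 1≤n one-or-all k k<m with one-or-all k k<m
  ... | inj₁ one = one
  ... | inj₂ all with another-point 2≤m k
  ...   | j , j<m , j≢k = ⊥-elim (m+1+n≰m n (≤-trans (+-monoʳ-≤ n nonempty) n+fj≤n))
    where
    nonempty : 1 ≤ fibreSize j
    nonempty with one-or-all j j<m
    ... | inj₁ one = subst (1 ≤_) (sym one) ≤-refl
    ... | inj₂ all = subst (1 ≤_) (sym all) 1≤n
    n+fj≤n : n + fibreSize j ≤ n
    n+fj≤n = subst (λ t → t + fibreSize j ≤ n) all (fibreSize-+-≤ (j≢k ∘ sym))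

g-one-zero : ∀ n x → zeros n x ≡ 1 → g n x ≡ false
g-one-zero n x one rewrite one = refl

g≡false⇒ : ∀ n x → g n x ≡ false → zeros n x ≡ 1 ⊎ zeros n x ≡ n
g≡false⇒ n x gx≡false with zeros n x ≟ 1 | zeros n x ≟ n
... | yes one | _       = inj₁ one
... | no _    | yes all = inj₂ all
... | no _    | no _    with gx≡false
...   | ()

lemma2 : (m n : ℕ) → 4 ≤ m → 4 ≤ n → ¬ (m ≡ n) → ¬ (g m ⪯V g n)
lemma2 m n 4≤m 4≤n m≢n (σ , gm≗gn∘σ) =
  m≢n (sym (singleton-fibres⇒≡ (one-or-all⇒singleton 2≤m 1≤n one-or-all)))
  where
  open Fibres σ
  2≤m : 2 ≤ m
  2≤m = ≤-trans (s≤s (s≤s z≤n)) 4≤m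
  1≤n : 1 ≤ n
  1≤n = ≤-trans (s≤s z≤n) 4≤n
  one-or-all : ∀ k → k < m → fibreSize k ≡ 1 ⊎ fibreSize k ≡ n
  one-or-all k k<m =
    g≡false⇒ n _ (trans (sym (gm≗gn∘σ (hole k))) (g-one-zero m (hole k) (zeros-hole m k k<m)))
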